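{- Let $G$ be a directed acyclic graph with $m$ edges, $s$ a vertex, $t$ a sink vertex, $\varepsilon>0$, and consider a run of $\mathrm{Walk}(G,s,t,\varepsilon)$ from arbitrary initial register values. Let $v$ be a vertex and let $(u_1,v),\dots,(u_d,v)$ be all edges entering $v$, where each $(u_i,v)$ is the $r_i$-th outgoing edge of $u_i$. Then $e_v\le\sum_{i=1}^d e_{u_i}^{r_i}$.
   Context: Let $K=\lceil 2m/\varepsilon\rceil$ and $\ell=\lceil\log_2 K\rceil$. The catalytic tape holds one $\ell$-bit register $R_v\in\{0,\dots,2^\ell-1\}$ per vertex $v$, with arbitrary initial content. $d_{\mathrm{out}}(v)$ is the out-degree of $v$ and the out-edges of $v$ are indexed $0,\dots,d_{\mathrm{out}}(v)-1$. Procedure $\mathrm{WalkOnce}(G,s,\mathrm{mode})$: set $v\gets s$; while $d_{\mathrm{out}}(v)>0$: if mode is Fwd, set $r\gets R_v \bmod d_{\mathrm{out}}(v)$ then $R_v\gets(R_v+1)\bmod 2^\ell$; if mode is Rev, set $R_v\gets (R_v-1)\bmod 2^\ell$ then $r\gets R_v\bmod d_{\mathrm{out}}(v)$; then set $v$ to the endpoint of the $r$-th out-edge of $v$. Return $v$. Each evaluation of the while-condition with current vertex $v$ counts as a visit to $v$. Procedure $\mathrm{Walk}(G,s,t,\varepsilon)$: forward phase: run $\mathrm{WalkOnce}(G,s,\mathrm{Fwd})$ $K$ times, letting $N_{\mathrm{reach}}$ be the number of runs returning $t$; reverse phase: run $\mathrm{WalkOnce}(G,s,\mathrm{Rev})$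 $K$ times; return $N_{\mathrm{reach}}/K$. Notation: $p_v$ is the probability that a random walk from $s$ (moving along a uniformly random out-edge each step) reaches $v$; $N_v$ is the number of visits to $v$ during the forward phase; $e_v=|N_v-Kp_v|$; for $r\in[d_{\mathrm{out}}(v)]$, $N_v^r$ is the number of those visits at which the $r$-th out-edge of $v$ was followed; $e_v^r=|N_v^r-Kp_v/d_{\mathrm{out}}(v)|$.
   Formalization: The parameter ε ranges over the positive rationals. -}

module Defs where

open import Data.Nat as ℕ using (ℕ; zero; suc; _^_)
open import Data.Nat.Properties using (m^n≢0)
open import Data.Nat.DivMod using (_%_; m%n<n)
open import Data.Nat.Logarithm using (⌈log₂_⌉)
open import Data.Fin using (Fin; fromℕ<; toℕ; _≟_)
open import Data.Maybe using (Maybe; just; nothing)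
open import Data.Product using (_×_; _,_; proj₁; proj₂)
open import Data.List using (List; []; _∷_; _++_)
open import Data.Integer as ℤ using (+_)
open import Data.Rational as ℚ using (ℚ; 0ℚ; 1ℚ; ceiling; _÷_)
open import Data.Rational.Properties using (pos⇒nonZero)
open import Relation.Nullary using (¬_; yes; no)
open import Relation.Binary.PropositionalEquality using (_≡_)

-- Directed multigraphs on vertex set Fin n, given by out-adjacency:
-- vertex u has out-degree (deg u) and its r-th out-edge (r : Fin (deg u))
-- goes to (tgt u r).

record Graph (n : ℕ) : Set where
  field
    deg : Fin n → ℕ
    tgt : (u : Fin n) → Fin (deg u) → Fin n
open Graph public

sumℕ : (k : ℕ) → (Fin k → ℕ) → ℕ
sumℕ zero    f = 0
sumℕ (suc k) f = f Fin.zero ℕ.+ sumℕ k (λ i → f (Fin.suc i))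

sumℚ : (k : ℕ) → (Fin k → ℚ) → ℚ
sumℚ zero    f = 0ℚ
sumℚ (suc k) f = f Fin.zero ℚ.+ sumℚ k (λ i → f (Fin.suc i))

edges : ∀ {n} → Graph n → ℕ
edges {n} G = sumℕ n (deg G)

data Path⁺ {n} (G : Graph n) : Fin n → Fin n → Set where
  edge : (u : Fin n) (r : Fin (deg G u)) → Path⁺ G u (tgt G u r)
  cons : (u : Fin n) (r : Fin (deg G u)) {w : Fin n} →
         Path⁺ G (tgt G u r) w → Path⁺ G u w

Acyclic : ∀ {n} → Graph n → Set
Acyclic {n} G = (v : Fin n) → ¬ Path⁺ G v v

Sink : ∀ {n} → Graph n → Fin n → Set
Sink G t = deg G t ≡ 0

Kpar : ℕ → (ε : ℚ) → 0ℚ ℚ.< ε → ℕ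
Kpar m ε ε>0 = ℤ.∣ ceiling ((ℚ._/_ (+ (2 ℕ.* m)) 1 ÷ ε) {{pos⇒nonZero ε {{ℚ.positive ε>0}}}}) ∣

ℓpar : ℕ → ℕ
ℓpar K = ⌈log₂ K ⌉

Regs : ℕ → Set
Regs n = Fin n → ℕ

update : ∀ {n} → Regs n → Fin n → ℕ → Regs n
update R v x w with w ≟ v
... | yes _ = x
... | no  _ = R w

-- A visit event: the visited vertex and (if it is not a sink) the index
-- of the out-edge that was followed at this visit.
Event : ℕ → Set
Event n = Fin n × Maybe ℕ

-- The fuel bounds the number of loop iterations; with fuel n on an acyclic
-- graph with n vertices it never runs out.  Returns final registers,
-- returned vertex and the list of visits (loop-condition evaluations).
walkFwd : ∀ {n} → Graph n → (ℓ : ℕ) → (fuel : ℕ) → Regs n → Fin n →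
          Regs n × Fin n × List (Event n)
walkFwd G ℓ zero    R v = R , v , []
walkFwd {n} G ℓ (suc f) R v = step (deg G v) (tgt G v)
  where
  step : (d : ℕ) → (Fin d → Fin n) → Regs n × Fin n × List (Event n)
  step zero    t = R , v , ((v , nothing) ∷ [])
  step (suc k) t with walkFwd G ℓ f
                        (update R v (_%_ (R v ℕ.+ 1) (2 ^ ℓ) {{m^n≢0 2 ℓ}}))
                        (t (fromℕ< (m%n<n (R v) (suc k))))
  ... | R' , w , tr = R' , w , ((v , just (R v % suc k)) ∷ tr)

forwardPhase : ∀ {n} → Graph n → (ℓ : ℕ) → (K : ℕ) → Regs n → Fin n →
               List (Event n) × Regs n
forwardPhase G ℓ zero    R s = [] , R
forwardPhase {n} G ℓ (suc K) R s with walkFwd G ℓ n R s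
... | R' , _ , tr with forwardPhase G ℓ K R' s
...   | tr' , R'' = tr ++ tr' , R''

visits : ∀ {n} → List (Event n) → Fin n → ℕ
visits []             v = 0
visits ((w , _) ∷ es) v with w ≟ v
... | yes _ = suc (visits es v)
... | no  _ = visits es v

edgeVisits : ∀ {n} → List (Event n) → Fin n → ℕ → ℕ
edgeVisits []                    v r = 0
edgeVisits ((w , nothing) ∷ es)  v r = edgeVisits es v r
edgeVisits ((w , just r') ∷ es)  v r with w ≟ v | r' ℕ.≟ r
... | yes _ | yes _ = suc (edgeVisits es v r)
... | _     | _     = edgeVisits es v r

-- p_v : probability that a random walk from s (uniform out-edge each step,
-- stopping at a sink) reaches v.  hit k w v = probability that the walk
-- started at w reaches v within k steps (first-step decomposition over
-- trajectories).  On a DAG with n vertices every walk has < n steps, so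
-- p_v = hit n s v.
hit : ∀ {n} → Graph n → ℕ → Fin n → Fin n → ℚ
hitStep : ∀ {n} → Graph n → ℕ → Fin n → (d : ℕ) → (Fin d → Fin n) → ℚ

hit G k w v with w ≟ v
hit G k       w v | yes _ = 1ℚ
hit G zero    w v | no  _ = 0ℚ
hit G (suc k) w v | no  _ = hitStep G k v (deg G w) (tgt G w)

hitStep G k v zero    t = 0ℚ
hitStep G k v (suc d) t = sumℚ (suc d) (λ r → hit G k (t r) v) ℚ.* (+ 1 ℚ./ suc d)

prob : ∀ {n} → Graph n → Fin n → Fin n → ℚ
prob {n} G s v = hit G n s v

errV : ∀ {n} → Graph n → (K : ℕ) → Fin n → List (Event n) → Fin n → ℚ
errV G K s tr v = ℚ.∣ (+ visits tr v ℚ./ 1) ℚ.- (+ K ℚ./ 1) ℚ.* prob G s v ∣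

-- e_u^r = |N_u^r − K p_u / d_out(u)|   (only used for r : Fin (deg u), so deg u > 0)
errE : ∀ {n} → (G : Graph n) → (K : ℕ) → Fin n → List (Event n) →
       (u : Fin n) → Fin (deg G u) → ℚ
errE {n} G K s tr u r = go (deg G u) (toℕ r)
  where
  go : ℕ → ℕ → ℚ
  go zero    i = 0ℚ
  go (suc d) i = ℚ.∣ (+ edgeVisits tr u i ℚ./ 1) ℚ.- ((+ K ℚ./ 1) ℚ.* prob G s u) ℚ.* (+ 1 ℚ./ suc d) ∣

inErrSum : ∀ {n} → Graph n → (K : ℕ) → Fin n → List (Event n) → Fin n → ℚ
inErrSum {n} G K s tr v =
  sumℚ n (λ u → sumℚ (deg G u) (λ r → inc (tgt G u r ≟ v) (errE G K s tr u r)))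
  where
  inc : ∀ {a b : Fin n} → Relation.Nullary.Dec (a ≡ b) → ℚ → ℚ
  inc (yes _) q = q
  inc (no _)  q = 0ℚ

module Submission where

-- Both e_v and the bound come from one flow equation along the in-edges of v.  Every visit to v either
-- starts a run (then v = s) or arrives along an in-edge (u, r) at a visit to u that chose r, so
-- N_v = K [s = v] + Σ N_u^r.  Dually, a last-step decomposition of the random walk gives
-- p_v = [s = v] + Σ p_u / d_out(u).  Acyclicity makes both exact: no run exhausts its fuel and the
-- hitting probabilities are stable after n steps.  Subtracting K times the second equation from the first,
-- N_v - K p_v = Σ (N_u^r - K p_u / d_out(u)), and the triangle inequality gives e_v ≤ Σ e_u^r.

open import Defs
open import Algebra.Bundles using (CommutativeRing)
open import Data.Empty using (⊥-elim)
open import Data.Fin as Fin using (Fin; zero; suc; toℕ; fromℕ<; punchIn; _≟_)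
open import Data.Fin.Properties using (punchInᵢ≢i; toℕ-fromℕ<; toℕ-injective; pigeonhole)
import Data.Integer as ℤ
import Data.Integer.Properties as ℤ
open import Data.List using (List; []; _∷_; _++_)
open import Data.Maybe using (just; nothing)
open import Data.Nat as ℕ using (ℕ; zero; suc; _<_; _^_)
import Data.Nat.Coprimality as Coprime
open import Data.Nat.DivMod using (_%_; m%n<n)
open import Data.Nat.Properties using (n<1+n; m^n≢0)
open import Data.Product using (_,_; proj₁; proj₂; ∃₂)
open import Data.Rational using (ℚ; mkℚ; 0ℚ; 1ℚ; _+_; _*_; _-_; ∣_∣; _/_; _≤_)
open import Data.Rational.Properties
  using ( +-*-commutativeRing; normalize-coprime; /-cong
        ; +-identityˡ; +-identityʳ; *-identityˡ; *-identityʳ; *-zeroˡ; *-zeroʳ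
        ; *-assoc; *-comm; *-distribˡ-+; *-distribʳ-+
        ; ≤-refl; ≤-reflexive; ≤-trans; +-mono-≤; +-monoʳ-≤; ∣p+q∣≤∣p∣+∣q∣; module ≤-Reasoning )
open import Data.Rational.Solver using (module +-*-Solver)
open import Data.Sum using (_⊎_; inj₁; inj₂)
open import Function using (_∘_)
open import Relation.Binary.PropositionalEquality
  using (_≡_; _≢_; refl; sym; trans; cong; cong₂; subst; module ≡-Reasoning)
open import Relation.Nullary using (Dec; yes; no; ¬_)

open import Algebra.Properties.Semiring.Sum (CommutativeRing.semiring +-*-commutativeRing)
  using (sum; sum-syntax; sum-cong-≗; sum-replicate-zero; sum-remove; ∑-distrib-+; ∑-comm; *-distribˡ-sum; *-distribʳ-sum)
open import Algebra.Properties.CommutativeSemigroup (CommutativeRing.*-commutativeSemigroup +-*-commutativeRing)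
  using (xy∙z≈xz∙y; xy∙z≈zx∙y)

sumℚ≡sum : ∀ k (f : Fin k → ℚ) → sumℚ k f ≡ sum f
sumℚ≡sum zero    f = refl
sumℚ≡sum (suc k) f = cong (f zero +_) (sumℚ≡sum k (f ∘ suc))

sum-zero : ∀ {k} {f : Fin k → ℚ} → (∀ i → f i ≡ 0ℚ) → sum f ≡ 0ℚ
sum-zero {k} f≡0 = trans (sum-cong-≗ f≡0) (sum-replicate-zero k)

sum-singleton : ∀ {k} {f : Fin k → ℚ} (j : Fin k) → (∀ i → i ≢ j → f i ≡ 0ℚ) → sum f ≡ f j
sum-singleton {suc k} {f} j f≡0 = begin
  sum f                        ≡⟨ sum-remove f ⟩
  f j + sum (f ∘ punchIn j)    ≡⟨ cong (f j +_) (sum-zero (λ i → f≡0 _ (punchInᵢ≢i j i))) ⟩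
  f j + 0ℚ                     ≡⟨ +-identityʳ (f j) ⟩
  f j                          ∎
  where open ≡-Reasoning

sum-mono-≤ : ∀ {k} {f g : Fin k → ℚ} → (∀ i → f i ≤ g i) → sum f ≤ sum g
sum-mono-≤ {zero}  f≤g = ≤-refl
sum-mono-≤ {suc k} f≤g = +-mono-≤ (f≤g zero) (sum-mono-≤ (f≤g ∘ suc))

∣sum-sum∣≤sum∣-∣ : ∀ {k} (f g : Fin k → ℚ) → ∣ sum f - sum g ∣ ≤ sum (λ i → ∣ f i - g i ∣)
∣sum-sum∣≤sum∣-∣ {zero}  f g = ≤-refl
∣sum-sum∣≤sum∣-∣ {suc k} f g = begin
  ∣ (f zero + F) - (g zero + G) ∣             ≡⟨ cong ∣_∣ (interchange (f zero) F (g zero) G) ⟩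
  ∣ (f zero - g zero) + (F - G) ∣             ≤⟨ ∣p+q∣≤∣p∣+∣q∣ (f zero - g zero) (F - G) ⟩
  ∣ f zero - g zero ∣ + ∣ F - G ∣             ≤⟨ +-monoʳ-≤ ∣ f zero - g zero ∣ (∣sum-sum∣≤sum∣-∣ (f ∘ suc) (g ∘ suc)) ⟩
  ∣ f zero - g zero ∣ + sum (λ i → ∣ f (suc i) - g (suc i) ∣) ∎
  where
  open ≤-Reasoning
  F = sum (f ∘ suc)
  G = sum (g ∘ suc)
  interchange : ∀ a b c d → (a + b) - (c + d) ≡ (a - c) + (b - d)
  interchange = solve 4 (λ a b c d → (a :+ b) :- (c :+ d) := (a :- c) :+ (b :- d)) refl
    where open +-*-Solver

𝟙 : {P : Set} → Dec P → ℚ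
𝟙 (yes _) = 1ℚ
𝟙 (no _)  = 0ℚ

∣𝟙*-𝟙*∣ : {P : Set} (D : Dec P) (a b : ℚ) → ∣ 𝟙 D * a - 𝟙 D * b ∣ ≡ 𝟙 D * ∣ a - b ∣
∣𝟙*-𝟙*∣ (yes _) a b rewrite *-identityˡ a | *-identityˡ b = sym (*-identityˡ ∣ a - b ∣)
∣𝟙*-𝟙*∣ (no _)  a b rewrite *-zeroˡ a | *-zeroˡ b = sym (*-zeroˡ ∣ a - b ∣)

δ : ∀ {n} → Fin n → Fin n → ℚ
δ a b = 𝟙 (a ≟ b)

δ-refl : ∀ {n} (a : Fin n) → δ a a ≡ 1ℚ
δ-refl a with a ≟ a
... | yes _  = refl
... | no a≢a = ⊥-elim (a≢a refl)

δ-≢ : ∀ {n} {a b : Fin n} → a ≢ b → δ a b ≡ 0ℚ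
δ-≢ {a = a} {b} a≢b with a ≟ b
... | yes a≡b = ⊥-elim (a≢b a≡b)
... | no _    = refl

fromℕ : ℕ → ℚ
fromℕ k = ℤ.+ k / 1

fromℕ-homo-+ : ∀ a b → fromℕ (a ℕ.+ b) ≡ fromℕ a + fromℕ b
fromℕ-homo-+ a b = sym (trans (cong₂ _+_ (mkℚ-form a) (mkℚ-form b))
                              (/-cong (cong₂ ℤ._+_ (ℤ.*-identityʳ (ℤ.+ a)) (ℤ.*-identityʳ (ℤ.+ b))) refl))
  where
  mkℚ-form : ∀ k → fromℕ k ≡ mkℚ (ℤ.+ k) 0 (Coprime.sym (Coprime.1-coprimeTo k))
  mkℚ-form k = normalize-coprime (Coprime.sym (Coprime.1-coprimeTo k))

-- inv 0 = 0 makes the mean over the (empty) out-edges of a sink 0, as in hitStep.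
inv : ℕ → ℚ
inv zero    = 0ℚ
inv (suc d) = ℤ.+ 1 / suc d

mean : (d : ℕ) → (Fin d → ℚ) → ℚ
mean d f = sum f * inv d

module _ {d : ℕ} where

  mean-cong : ∀ {f g : Fin d → ℚ} → (∀ i → f i ≡ g i) → mean d f ≡ mean d g
  mean-cong f≡g = cong (_* inv d) (sum-cong-≗ f≡g)

  mean-zero : ∀ {f : Fin d → ℚ} → (∀ i → f i ≡ 0ℚ) → mean d f ≡ 0ℚ
  mean-zero f≡0 = trans (cong (_* inv d) (sum-zero f≡0)) (*-zeroˡ (inv d))

  mean-+ : ∀ (f g : Fin d → ℚ) → mean d (λ i → f i + g i) ≡ mean d f + mean d g
  mean-+ f g = trans (cong (_* inv d) (∑-distrib-+ f g)) (*-distribʳ-+ (inv d) (sum f) (sum g))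

  mean-*ʳ : ∀ (f : Fin d → ℚ) c → mean d (λ i → f i * c) ≡ mean d f * c
  mean-*ʳ f c = trans (cong (_* inv d) (sym (*-distribʳ-sum c f))) (xy∙z≈xz∙y (sum f) c (inv d))

module _ {n : ℕ} where

  visits-++ : ∀ (a b : List (Event n)) v → visits (a ++ b) v ≡ visits a v ℕ.+ visits b v
  visits-++ []            b v = refl
  visits-++ ((w , _) ∷ a) b v with w ≟ v
  ... | yes _ = cong suc (visits-++ a b v)
  ... | no  _ = visits-++ a b v

  edgeVisits-++ : ∀ (a b : List (Event n)) v i → edgeVisits (a ++ b) v i ≡ edgeVisits a v i ℕ.+ edgeVisits b v i
  edgeVisits-++ []                   b v i = refl
  edgeVisits-++ ((w , nothing) ∷ a)  b v i = edgeVisits-++ a b v i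
  edgeVisits-++ ((w , just j) ∷ a)   b v i with w ≟ v | j ℕ.≟ i
  ... | yes _ | yes _ = cong suc (edgeVisits-++ a b v i)
  ... | yes _ | no  _ = edgeVisits-++ a b v i
  ... | no  _ | _     = edgeVisits-++ a b v i

  edgeVisits-self : ∀ (w : Fin n) i → edgeVisits ((w , just i) ∷ []) w i ≡ 1
  edgeVisits-self w i with w ≟ w | i ℕ.≟ i
  ... | yes _ | yes _ = refl
  ... | no w≢w | _    = ⊥-elim (w≢w refl)
  ... | yes _ | no i≢i = ⊥-elim (i≢i refl)

  edgeVisits-other : ∀ {w u : Fin n} {i j} → w ≢ u ⊎ i ≢ j → edgeVisits ((w , just i) ∷ []) u j ≡ 0
  edgeVisits-other {w} {u} {i} {j} other with w ≟ u | i ℕ.≟ j | other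
  ... | yes w≡u | yes i≡j | inj₁ w≢u = ⊥-elim (w≢u w≡u)
  ... | yes w≡u | yes i≡j | inj₂ i≢j = ⊥-elim (i≢j i≡j)
  ... | yes _   | no  _   | _        = refl
  ... | no  _   | _       | _        = refl

module _ {n : ℕ} (G : Graph n) where

  EdgeFn : Set
  EdgeFn = (u : Fin n) → Fin (deg G u) → ℚ

  into : Fin n → EdgeFn → EdgeFn
  into x f u r = 𝟙 (tgt G u r ≟ x) * f u r

  inSum : EdgeFn → Fin n → ℚ
  inSum f x = ∑[ u < n ] ∑[ r < deg G u ] into x f u r

  module _ {x : Fin n} where

    inSum-cong : ∀ {f g} → (∀ u r → f u r ≡ g u r) → inSum f x ≡ inSum g x
    inSum-cong f≡g = sum-cong-≗ λ u → sum-cong-≗ λ r → cong (𝟙 (tgt G u r ≟ x) *_) (f≡g u r)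

    inSum-zero : ∀ {f} → (∀ u r → f u r ≡ 0ℚ) → inSum f x ≡ 0ℚ
    inSum-zero f≡0 = sum-zero λ u → sum-zero λ r →
      trans (cong (𝟙 (tgt G u r ≟ x) *_) (f≡0 u r)) (*-zeroʳ (𝟙 (tgt G u r ≟ x)))

    inSum-at : ∀ {f} (w : Fin n) → (∀ u r → u ≢ w → f u r ≡ 0ℚ) → inSum f x ≡ ∑[ r < deg G w ] into x f w r
    inSum-at w f≡0 = sum-singleton w λ u u≢w → sum-zero λ r →
      trans (cong (𝟙 (tgt G u r ≟ x) *_) (f≡0 u r u≢w)) (*-zeroʳ (𝟙 (tgt G u r ≟ x)))

    inSum-+ : ∀ f g → inSum (λ u r → f u r + g u r) x ≡ inSum f x + inSum g x
    inSum-+ f g = trans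
      (sum-cong-≗ λ u → trans (sum-cong-≗ λ r → *-distribˡ-+ (𝟙 (tgt G u r ≟ x)) (f u r) (g u r))
                              (∑-distrib-+ (into x f u) (into x g u)))
      (∑-distrib-+ (λ u → sum (into x f u)) (λ u → sum (into x g u)))

    inSum-*ʳ : ∀ f c → inSum (λ u r → f u r * c) x ≡ inSum f x * c
    inSum-*ʳ f c = sym (trans (*-distribʳ-sum c (λ u → sum (into x f u)))
      (sum-cong-≗ λ u → trans (*-distribʳ-sum c (into x f u))
                              (sum-cong-≗ λ r → *-assoc (𝟙 (tgt G u r ≟ x)) (f u r) c)))

    inSum-sum : ∀ {k} (F : Fin k → EdgeFn) →
                inSum (λ u r → ∑[ i < k ] F i u r) x ≡ ∑[ i < k ] inSum (F i) x
    inSum-sum F = trans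
      (sum-cong-≗ λ u → trans (sum-cong-≗ λ r → *-distribˡ-sum (𝟙 (tgt G u r ≟ x)) (λ i → F i u r))
                              (∑-comm (λ r i → into x (F i) u r)))
      (∑-comm (λ u i → sum (into x (F i) u)))

    ∣inSum-inSum∣≤inSum∣-∣ : ∀ f g → ∣ inSum f x - inSum g x ∣ ≤ inSum (λ u r → ∣ f u r - g u r ∣) x
    ∣inSum-inSum∣≤inSum∣-∣ f g =
      ≤-trans (∣sum-sum∣≤sum∣-∣ (λ u → sum (into x f u)) (λ u → sum (into x g u))) (sum-mono-≤ λ u →
      ≤-trans (∣sum-sum∣≤sum∣-∣ (into x f u) (into x g u))
              (≤-reflexive (sum-cong-≗ λ r → ∣𝟙*-𝟙*∣ (tgt G u r ≟ x) (f u r) (g u r))))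

  mean-inSum : ∀ {k} (F : Fin k → EdgeFn) x →
               mean k (λ i → inSum (F i) x) ≡ inSum (λ u r → mean k (λ i → F i u r)) x
  mean-inSum {k} F x = trans (cong (_* inv k) (sym (inSum-sum F))) (sym (inSum-*ʳ (λ u r → ∑[ i < k ] F i u r) (inv k)))

  data Walk : Fin n → ℕ → Set where
    []  : ∀ {w} → Walk w 0
    _∷_ : ∀ {w k} (r : Fin (deg G w)) → Walk (tgt G w r) k → Walk w (suc k)

  vertex : ∀ {w k} → Walk w k → Fin (suc k) → Fin n
  vertex {w} p       zero    = w
  vertex     (r ∷ p) (suc i) = vertex p i

  path-from-start : ∀ {w k} (p : Walk w k) (j : Fin k) → Path⁺ G w (vertex p (suc j))
  path-from-start {w} (r ∷ p) zero    = edge w r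
  path-from-start {w} (r ∷ p) (suc j) = cons w r (path-from-start p j)

  path-between : ∀ {w k} (p : Walk w k) (i j : Fin (suc k)) → i Fin.< j → Path⁺ G (vertex p i) (vertex p j)
  path-between p       zero    (suc j) _         = path-from-start p j
  path-between (r ∷ p) (suc i) (suc j) (ℕ.s≤s i<j) = path-between p i j i<j

  acyclic⇒¬Walk : Acyclic G → ∀ w → ¬ Walk w n
  acyclic⇒¬Walk acyclic w p with pigeonhole (n<1+n n) (vertex p)
  ... | i , j , i<j , vᵢ≡vⱼ = acyclic (vertex p i) (subst (Path⁺ G (vertex p i)) (sym vᵢ≡vⱼ) (path-between p i j i<j))

  hitStep≡mean : ∀ k v d (t : Fin d → Fin n) → hitStep G k v d t ≡ mean d (λ r → hit G k (t r) v)
  hitStep≡mean k v zero    t = refl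
  hitStep≡mean k v (suc d) t = cong (_* inv (suc d)) (sumℚ≡sum (suc d) (λ r → hit G k (t r) v))

  hit-zero : ∀ w v → hit G 0 w v ≡ δ w v
  hit-zero w v with w ≟ v
  ... | yes _ = refl
  ... | no  _ = refl

  hit-unreachable : ∀ k {w v} → w ≢ v → ¬ Path⁺ G w v → hit G k w v ≡ 0ℚ
  hit-unreachable k {w} {v} w≢v _ with w ≟ v
  ... | yes w≡v = ⊥-elim (w≢v w≡v)
  hit-unreachable zero    _ _ | no _ = refl
  hit-unreachable (suc k) {w} {v} _ ¬w⇝v | no _ =
    trans (hitStep≡mean k v (deg G w) (tgt G w)) (mean-zero λ r →
      hit-unreachable k (λ wᵣ≡v → ¬w⇝v (subst (Path⁺ G w) wᵣ≡v (edge w r))) (¬w⇝v ∘ cons w r))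

  hit-firstStep : Acyclic G → ∀ k w v → hit G (suc k) w v ≡ δ w v + mean (deg G w) (λ r → hit G k (tgt G w r) v)
  hit-firstStep acyclic k w v with w ≟ v
  ... | yes refl = sym (trans (cong (1ℚ +_) (mean-zero λ r →
          hit-unreachable k (λ wᵣ≡w → acyclic w (subst (Path⁺ G w) wᵣ≡w (edge w r))) (acyclic w ∘ cons w r)))
        (+-identityʳ 1ℚ))
  ... | no  _    = trans (hitStep≡mean k v (deg G w) (tgt G w)) (sym (+-identityˡ _))

  hit-stable : ∀ k {w} v → ¬ Walk w k → hit G (suc k) w v ≡ hit G k w v
  hit-stable zero    v ¬walk = ⊥-elim (¬walk [])
  hit-stable (suc k) {w} v ¬walk with w ≟ v
  ... | yes _ = refl
  ... | no  _ = trans (hitStep≡mean (suc k) v (deg G w) (tgt G w))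
                (trans (mean-cong λ r → hit-stable k v (¬walk ∘ (r ∷_)))
                       (sym (hitStep≡mean k v (deg G w) (tgt G w))))

  mean-out-δ : ∀ w x → mean (deg G w) (λ r → δ (tgt G w r) x) ≡ inSum (λ u _ → δ w u * inv (deg G u)) x
  mean-out-δ w x = begin
    mean (deg G w) (λ r → δ (tgt G w r) x)
      ≡⟨ *-distribʳ-sum (inv (deg G w)) (λ r → δ (tgt G w r) x) ⟩
    ∑[ r < deg G w ] (δ (tgt G w r) x * inv (deg G w))
      ≡⟨ sum-cong-≗ (λ r → cong (δ (tgt G w r) x *_) (sym (trans (cong (_* inv (deg G w)) (δ-refl w)) (*-identityˡ _)))) ⟩
    ∑[ r < deg G w ] into x (λ u _ → δ w u * inv (deg G u)) w r
      ≡⟨ sym (inSum-at w (λ u _ u≢w → trans (cong (_* inv (deg G u)) (δ-≢ (u≢w ∘ sym))) (*-zeroˡ (inv (deg G u))))) ⟩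
    inSum (λ u _ → δ w u * inv (deg G u)) x
      ∎
    where open ≡-Reasoning

  firstStep≡lastStep : Acyclic G → ∀ k w x →
             mean (deg G w) (λ r → hit G k (tgt G w r) x) ≡ inSum (λ u _ → hit G k w u * inv (deg G u)) x
  firstStep≡lastStep acyclic zero w x = begin
    mean (deg G w) (λ r → hit G 0 (tgt G w r) x)   ≡⟨ mean-cong (λ r → hit-zero (tgt G w r) x) ⟩
    mean (deg G w) (λ r → δ (tgt G w r) x)         ≡⟨ mean-out-δ w x ⟩
    inSum (λ u _ → δ w u * inv (deg G u)) x        ≡⟨ inSum-cong (λ u _ → cong (_* inv (deg G u)) (sym (hit-zero w u))) ⟩
    inSum (λ u _ → hit G 0 w u * inv (deg G u)) x  ∎
    where open ≡-Reasoning
  firstStep≡lastStep acyclic (suc k) w x = begin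
    mean d (λ r → hit G (suc k) (tgt G w r) x)
      ≡⟨ mean-cong (λ r → trans (hit-firstStep acyclic k (tgt G w r) x) (cong (δ (tgt G w r) x +_) (firstStep≡lastStep acyclic k (tgt G w r) x))) ⟩
    mean d (λ r → δ (tgt G w r) x + inSum (λ u _ → hit G k (tgt G w r) u * inv (deg G u)) x)
      ≡⟨ mean-+ (λ r → δ (tgt G w r) x) (λ r → inSum (λ u _ → hit G k (tgt G w r) u * inv (deg G u)) x) ⟩
    mean d (λ r → δ (tgt G w r) x) + mean d (λ r → inSum (λ u _ → hit G k (tgt G w r) u * inv (deg G u)) x)
      ≡⟨ cong₂ _+_ (mean-out-δ w x) (mean-inSum (λ r u _ → hit G k (tgt G w r) u * inv (deg G u)) x) ⟩
    inSum (λ u _ → δ w u * inv (deg G u)) x + inSum (λ u _ → mean d (λ r → hit G k (tgt G w r) u * inv (deg G u))) x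
      ≡⟨ sym (inSum-+ (λ u _ → δ w u * inv (deg G u)) (λ u _ → mean d (λ r → hit G k (tgt G w r) u * inv (deg G u)))) ⟩
    inSum (λ u _ → δ w u * inv (deg G u) + mean d (λ r → hit G k (tgt G w r) u * inv (deg G u))) x
      ≡⟨ inSum-cong (λ u _ → trans (cong (δ w u * inv (deg G u) +_) (mean-*ʳ (λ r → hit G k (tgt G w r) u) (inv (deg G u))))
                                   (sym (*-distribʳ-+ (inv (deg G u)) (δ w u) _))) ⟩
    inSum (λ u _ → (δ w u + mean d (λ r → hit G k (tgt G w r) u)) * inv (deg G u)) x
      ≡⟨ inSum-cong (λ u _ → cong (_* inv (deg G u)) (sym (hit-firstStep acyclic k w u))) ⟩
    inSum (λ u _ → hit G (suc k) w u * inv (deg G u)) x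
      ∎
    where
    open ≡-Reasoning
    d = deg G w

  prob-flow : Acyclic G → ∀ s x → prob G s x ≡ δ s x + inSum (λ u _ → prob G s u * inv (deg G u)) x
  prob-flow acyclic s x = begin
    hit G n s x                                          ≡⟨ sym (hit-stable n x (acyclic⇒¬Walk acyclic s)) ⟩
    hit G (suc n) s x                                    ≡⟨ hit-firstStep acyclic n s x ⟩
    δ s x + mean (deg G s) (λ r → hit G n (tgt G s r) x) ≡⟨ cong (δ s x +_) (firstStep≡lastStep acyclic n s x) ⟩
    δ s x + inSum (λ u _ → hit G n s u * inv (deg G u)) x ∎
    where open ≡-Reasoning

  visitCount : List (Event n) → Fin n → ℚ
  visitCount tr x = fromℕ (visits tr x)

  edgeCount : List (Event n) → EdgeFn
  edgeCount tr u r = fromℕ (edgeVisits tr u (toℕ r))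

  inflow : List (Event n) → Fin n → ℚ
  inflow tr = inSum (edgeCount tr)

  visitCount-++ : ∀ a b x → visitCount (a ++ b) x ≡ visitCount a x + visitCount b x
  visitCount-++ a b x = trans (cong fromℕ (visits-++ a b x)) (fromℕ-homo-+ (visits a x) (visits b x))

  visitCount-event : ∀ w m x → visitCount ((w , m) ∷ []) x ≡ δ w x
  visitCount-event w m x with w ≟ x
  ... | yes _ = refl
  ... | no  _ = refl

  inflow-++ : ∀ a b x → inflow (a ++ b) x ≡ inflow a x + inflow b x
  inflow-++ a b x = trans
    (inSum-cong λ u r → trans (cong fromℕ (edgeVisits-++ a b u (toℕ r)))
                              (fromℕ-homo-+ (edgeVisits a u (toℕ r)) (edgeVisits b u (toℕ r))))
    (inSum-+ (edgeCount a) (edgeCount b))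

  inflow-edge : ∀ w r x → inflow ((w , just (toℕ r)) ∷ []) x ≡ δ (tgt G w r) x
  inflow-edge w r x = begin
    inflow e x
      ≡⟨ inSum-at w (λ u _ u≢w → cong fromℕ (edgeVisits-other {w = w} (inj₁ (u≢w ∘ sym)))) ⟩
    ∑[ r′ < deg G w ] into x (edgeCount e) w r′
      ≡⟨ sum-singleton r (λ r′ r′≢r → trans
           (cong (λ c → 𝟙 (tgt G w r′ ≟ x) * fromℕ c) (edgeVisits-other {w = w} (inj₂ (r′≢r ∘ sym ∘ toℕ-injective))))
           (*-zeroʳ (𝟙 (tgt G w r′ ≟ x)))) ⟩
    𝟙 (tgt G w r ≟ x) * fromℕ (edgeVisits e w (toℕ r))
      ≡⟨ cong (λ c → 𝟙 (tgt G w r ≟ x) * fromℕ c) (edgeVisits-self w (toℕ r)) ⟩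
    𝟙 (tgt G w r ≟ x) * 1ℚ
      ≡⟨ *-identityʳ (𝟙 (tgt G w r ≟ x)) ⟩
    δ (tgt G w r) x
      ∎
    where
    open ≡-Reasoning
    e = (w , just (toℕ r)) ∷ []

  module _ (ℓ : ℕ) where

    trace : ℕ → Regs n → Fin n → List (Event n)
    trace fuel R w = proj₂ (proj₂ (walkFwd G ℓ fuel R w))

    trace-suc : ∀ fuel R w →
      trace (suc fuel) R w ≡ (w , nothing) ∷ [] ⊎
      ∃₂ λ (r : Fin (deg G w)) R′ → trace (suc fuel) R w ≡ (w , just (toℕ r)) ∷ trace fuel R′ (tgt G w r)
    trace-suc fuel R w with deg G w | tgt G w
    ... | zero  | _ = inj₁ refl
    ... | suc d | t = inj₂ (fromℕ< r<d , R′ , cong (λ i → (w , just i) ∷ trace fuel R′ (t (fromℕ< r<d))) (sym (toℕ-fromℕ< r<d)))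
      where
      r<d = m%n<n (R w) (suc d)
      R′ = update R w (((R w ℕ.+ 1) % 2 ^ ℓ) {{m^n≢0 2 ℓ}})

    walk-flow : ∀ fuel R w x → ¬ Walk w fuel → visitCount (trace fuel R w) x ≡ δ w x + inflow (trace fuel R w) x
    walk-flow zero       R w x ¬walk = ⊥-elim (¬walk [])
    walk-flow (suc fuel) R w x ¬walk with trace-suc fuel R w
    ... | inj₁ stop rewrite stop =
      trans (visitCount-event w nothing x) (sym (trans (cong (δ w x +_) (inSum-zero λ _ _ → refl)) (+-identityʳ (δ w x))))
    ... | inj₂ (r , R′ , move) rewrite move = begin
      visitCount (e ∷ tr) x                     ≡⟨ visitCount-++ (e ∷ []) tr x ⟩
      visitCount (e ∷ []) x + visitCount tr x   ≡⟨ cong₂ _+_ (visitCount-event w (just (toℕ r)) x)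
                                                            (walk-flow fuel R′ (tgt G w r) x (¬walk ∘ (r ∷_))) ⟩
      δ w x + (δ (tgt G w r) x + inflow tr x)   ≡⟨ cong (λ y → δ w x + (y + inflow tr x)) (sym (inflow-edge w r x)) ⟩
      δ w x + (inflow (e ∷ []) x + inflow tr x) ≡⟨ cong (δ w x +_) (sym (inflow-++ (e ∷ []) tr x)) ⟩
      δ w x + inflow (e ∷ tr) x                 ∎
      where
      open ≡-Reasoning
      e = (w , just (toℕ r))
      tr = trace fuel R′ (tgt G w r)

    phaseTrace : ℕ → Regs n → Fin n → List (Event n)
    phaseTrace K R s = proj₁ (forwardPhase G ℓ K R s)

    phase-flow : Acyclic G → ∀ K R s x → visitCount (phaseTrace K R s) x ≡ fromℕ K * δ s x + inflow (phaseTrace K R s) x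
    phase-flow acyclic zero    R s x =
      sym (trans (cong₂ _+_ (*-zeroˡ (δ s x)) (inSum-zero λ _ _ → refl)) (+-identityʳ 0ℚ))
    phase-flow acyclic (suc K) R s x = begin
      visitCount (tr ++ tr′) x
        ≡⟨ visitCount-++ tr tr′ x ⟩
      visitCount tr x + visitCount tr′ x
        ≡⟨ cong₂ _+_ (walk-flow n R s x (acyclic⇒¬Walk acyclic s)) (phase-flow acyclic K R′ s x) ⟩
      (δ s x + inflow tr x) + (fromℕ K * δ s x + inflow tr′ x)
        ≡⟨ regroup (δ s x) (inflow tr x) (fromℕ K) (inflow tr′ x) ⟩
      (1ℚ + fromℕ K) * δ s x + (inflow tr x + inflow tr′ x)
        ≡⟨ cong₂ _+_ (cong (_* δ s x) (sym (fromℕ-homo-+ 1 K))) (sym (inflow-++ tr tr′ x)) ⟩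
      fromℕ (suc K) * δ s x + inflow (tr ++ tr′) x
        ∎
      where
      open ≡-Reasoning
      tr = trace n R s
      R′ = proj₁ (walkFwd G ℓ n R s)
      tr′ = phaseTrace K R′ s
      regroup : ∀ d a k b → (d + a) + (k * d + b) ≡ (1ℚ + k) * d + (a + b)
      regroup = solve 4 (λ d a k b → (d :+ a) :+ (k :* d :+ b) := (con 1ℚ :+ k) :* d :+ (a :+ b)) refl
        where open +-*-Solver

  errE≡ : ∀ K s tr u r → errE G K s tr u r ≡ ∣ edgeCount tr u r - (fromℕ K * prob G s u) * inv (deg G u) ∣
  errE≡ K s tr u r with deg G u in deg≡ | toℕ r
  ... | zero  | _ with () ← subst Fin deg≡ r
  ... | suc _ | _ = refl

  -- The left-hand side is the summand of inErrSum, whose selector is local to Defs and cannot be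
  -- named; it is determined by unification in inErrSum≡inSum.
  inErrSum-summand : ∀ K s tr v u r → _ ≡ into v (errE G K s tr) u r

  inErrSum≡inSum : ∀ K s tr v → inErrSum G K s tr v ≡ inSum (errE G K s tr) v
  inErrSum≡inSum K s tr v = trans (sumℚ≡sum n _) (sum-cong-≗ λ u →
    trans (sumℚ≡sum (deg G u) _) (sum-cong-≗ λ r → inErrSum-summand K s tr v u r))

  inErrSum-summand K s tr v u r with tgt G u r ≟ v
  ... | yes _ = sym (*-identityˡ (errE G K s tr u r))
  ... | no  _ = sym (*-zeroˡ (errE G K s tr u r))

  errV≤inErrSum : Acyclic G → ∀ ℓ K R s v →
                  errV G K s (phaseTrace ℓ K R s) v ≤ inErrSum G K s (phaseTrace ℓ K R s) v
  errV≤inErrSum acyclic ℓ K R s v = begin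
    ∣ visitCount tr v - k * prob G s v ∣
      ≡⟨ cong₂ (λ a b → ∣ a - b ∣) (phase-flow ℓ acyclic K R s v) scaled-prob-flow ⟩
    ∣ (k * δ s v + inflow tr v) - (k * δ s v + inSum expected v) ∣
      ≡⟨ cong ∣_∣ (cancel (k * δ s v) (inflow tr v) (inSum expected v)) ⟩
    ∣ inflow tr v - inSum expected v ∣
      ≤⟨ ∣inSum-inSum∣≤inSum∣-∣ (edgeCount tr) expected ⟩
    inSum (λ u r → ∣ edgeCount tr u r - expected u r ∣) v
      ≡⟨ inSum-cong (λ u r → sym (errE≡ K s tr u r)) ⟩
    inSum (errE G K s tr) v
      ≡⟨ sym (inErrSum≡inSum K s tr v) ⟩
    inErrSum G K s tr v
      ∎
    where
    open ≤-Reasoning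
    k = fromℕ K
    tr = phaseTrace ℓ K R s
    expected : EdgeFn
    expected u _ = (k * prob G s u) * inv (deg G u)
    scaled-prob-flow : k * prob G s v ≡ k * δ s v + inSum expected v
    scaled-prob-flow = begin-equality
      k * prob G s v
        ≡⟨ cong (k *_) (prob-flow acyclic s v) ⟩
      k * (δ s v + inSum flow v)
        ≡⟨ *-distribˡ-+ k (δ s v) (inSum flow v) ⟩
      k * δ s v + k * inSum flow v
        ≡⟨ cong (k * δ s v +_) (trans (*-comm k (inSum flow v)) (sym (inSum-*ʳ flow k))) ⟩
      k * δ s v + inSum (λ u r → flow u r * k) v
        ≡⟨ cong (k * δ s v +_) (inSum-cong λ u _ → xy∙z≈zx∙y (prob G s u) (inv (deg G u)) k) ⟩
      k * δ s v + inSum expected v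
        ∎
      where
      flow : EdgeFn
      flow u _ = prob G s u * inv (deg G u)
    cancel : ∀ c a b → (c + a) - (c + b) ≡ a - b
    cancel = solve 3 (λ c a b → (c :+ a) :- (c :+ b) := a :- b) refl
      where open +-*-Solver

lemma4p4 : {n : ℕ} (G : Graph n) → Acyclic G →
    (s t : Fin n) → Sink G t →
    (ε : ℚ) (ε>0 : 0ℚ Data.Rational.< ε) →
    (R₀ : Regs n) → ((w : Fin n) → R₀ w < 2 ^ ℓpar (Kpar (edges G) ε ε>0)) →
    (v : Fin n) →
    errV G (Kpar (edges G) ε ε>0) s
      (proj₁ (forwardPhase G (ℓpar (Kpar (edges G) ε ε>0)) (Kpar (edges G) ε ε>0) R₀ s)) v
    ≤ inErrSum G (Kpar (edges G) ε ε>0) s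
      (proj₁ (forwardPhase G (ℓpar (Kpar (edges G) ε ε>0)) (Kpar (edges G) ε ε>0) R₀ s)) v
lemma4p4 G acyclic s _ _ ε ε>0 R₀ _ v = errV≤inErrSum G acyclic (ℓpar K) K R₀ s v
  where K = Kpar (edges G) ε ε>0
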